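{- Let $V=\{1,\dots,n\}$, let $f:2^V\to\mathbb{R}$ be submodular with $f(\emptyset)=0$, and let $Y\subseteq V$. Define the polyhedra $\partial^f_{i,1}(Y)=\{x\in\mathbb{R}^n: x(j)\le f(j\mid Y\setminus\{j\})\ \forall j\in Y,\ x(j)\ge f(\{j\})\ \forall j\notin Y\}$, $\partial^f_{i,2}(Y)=\{x\in\mathbb{R}^n: x(j)\le f(j\mid V\setminus\{j\})\ \forall j\in Y,\ x(j)\ge f(j\mid Y)\ \forall j\notin Y\}$, $\partial^f_{i,3}(Y)=\{x\in\mathbb{R}^n: x(j)\le f(j\mid V\setminus\{j\})\ \forall j\in Y,\ x(j)\ge f(\{j\})\ \forall j\notin Y\}$, and $\partial^f_{i,(1,2)}(Y)=\{\lambda x_1+(1-\lambda)x_2: \lambda\in[0,1],\ x_1\in\partial^f_{i,1}(Y),\ x_2\in\partial^f_{i,2}(Y)\}$. Let $\partial^f(Y)=\{x\in\mathbb{R}^n: f(Z)-x(Z)\le f(Y)-x(Y)\ \forall Z\subseteq V\}$. Then $$\partial^f_{i,3}(Y)\subseteq\partial^f_{i,2}(Y)\subseteq\partial^f_{i,(1,2)}(Y)\subseteq\partial^f(Y),$$ $$\partial^f_{i,3}(Y)\subseteq\partial^f_{i,1}(Y)\subseteq\partial^f_{i,(1,2)}(Y)\subseteq\partial^f(Y).$$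
   Context: A set function $f:2^V\to\mathbb{R}$ is submodular if $f(S)+f(T)\ge f(S\cup T)+f(S\cap T)$ for all $S,T\subseteq V$. For $j\in V$ and $S\subseteq V$, $f(j\mid S)=f(S\cup\{j\})-f(S)$. For $x\in\mathbb{R}^n$ and $S\subseteq V$, $x(S)=\sum_{i\in S}x(i)$. -}

module Defs where

open import Level using (Level; _⊔_; suc)
open import Data.Nat using (ℕ)
open import Data.Fin using (Fin) renaming (zero to fzero; suc to fsuc)
open import Data.Fin.Subset using (Subset; _∈_; _∉_; _∪_; _∩_; ⁅_⁆; ⊤; ⊥)
open import Data.Fin.Subset using () renaming (_-_ to _∖_)
open import Data.Vec using (lookup)
open import Data.Bool using (if_then_else_)
open import Data.Product using (Σ; ∃; _×_)
open import Relation.Nullary using (¬_)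
open import Relation.Binary.Structures using (IsTotalOrder)
open import Algebra.Bundles using (CommutativeRing)

-- An ordered field (the real numbers ℝ are the intended instance; the
-- standard library has no real numbers, so we work over an arbitrary
-- ordered field given by its axioms).
record OrderedField (c ℓ₁ ℓ₂ : Level) : Set (Level.suc (c ⊔ ℓ₁ ⊔ ℓ₂)) where
  field
    commutativeRing : CommutativeRing c ℓ₁
  open CommutativeRing commutativeRing public
  infix 4 _≤_
  field
    _≤_          : Carrier → Carrier → Set ℓ₂
    isTotalOrder : IsTotalOrder _≈_ _≤_
    0≉1          : ¬ (0# ≈ 1#)
    inverse      : ∀ x → ¬ (x ≈ 0#) → ∃ λ y → x * y ≈ 1#
    +-monoˡ-≤    : ∀ {x y} z → x ≤ y → x + z ≤ y + z
    *-nonneg     : ∀ {x y} → 0# ≤ x → 0# ≤ y → 0# ≤ x * y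

module SubmodularDefs {c ℓ₁ ℓ₂ : Level} (F : OrderedField c ℓ₁ ℓ₂) where
  open OrderedField F

  sumFin : ∀ {m : ℕ} → (Fin m → Carrier) → Carrier
  sumFin {ℕ.zero}  g = 0#
  sumFin {ℕ.suc m} g = g fzero + sumFin (λ i → g (fsuc i))

  _⟨_⟩ : ∀ {n} → (Fin n → Carrier) → Subset n → Carrier
  x ⟨ S ⟩ = sumFin (λ i → if lookup S i then x i else 0#)

  Submodular : ∀ {n} → (Subset n → Carrier) → Set ℓ₂
  Submodular f = ∀ S T → f (S ∪ T) + f (S ∩ T) ≤ f S + f T

  marg : ∀ {n} → (Subset n → Carrier) → Fin n → Subset n → Carrier
  marg f j S = f (S ∪ ⁅ j ⁆) - f S

  ∂i1 : ∀ {n} → (Subset n → Carrier) → Subset n → (Fin n → Carrier) → Set ℓ₂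
  ∂i1 f Y x = (∀ j → j ∈ Y → x j ≤ marg f j (Y ∖ j))
            × (∀ j → j ∉ Y → f ⁅ j ⁆ ≤ x j)

  ∂i2 : ∀ {n} → (Subset n → Carrier) → Subset n → (Fin n → Carrier) → Set ℓ₂
  ∂i2 f Y x = (∀ j → j ∈ Y → x j ≤ marg f j (⊤ ∖ j))
            × (∀ j → j ∉ Y → marg f j Y ≤ x j)

  ∂i3 : ∀ {n} → (Subset n → Carrier) → Subset n → (Fin n → Carrier) → Set ℓ₂
  ∂i3 f Y x = (∀ j → j ∈ Y → x j ≤ marg f j (⊤ ∖ j))
            × (∀ j → j ∉ Y → f ⁅ j ⁆ ≤ x j)

  ∂i12 : ∀ {n} → (Subset n → Carrier) → Subset n → (Fin n → Carrier) → Set (c ⊔ ℓ₁ ⊔ ℓ₂)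
  ∂i12 f Y x = Σ Carrier λ λ′ → Σ (_ → Carrier) λ x₁ → Σ (_ → Carrier) λ x₂ →
      (0# ≤ λ′) × (λ′ ≤ 1#) × ∂i1 f Y x₁ × ∂i2 f Y x₂
    × (∀ i → x i ≈ λ′ * x₁ i + (1# - λ′) * x₂ i)

  ∂f : ∀ {n} → (Subset n → Carrier) → Subset n → (Fin n → Carrier) → Set ℓ₂
  ∂f f Y x = ∀ Z → f Z - x ⟨ Z ⟩ ≤ f Y - x ⟨ Y ⟩

  _⊑_ : ∀ {a b n} → ((Fin n → Carrier) → Set a) → ((Fin n → Carrier) → Set b) → Set (c ⊔ a ⊔ b)
  P ⊑ Q = ∀ x → P x → Q x

-- Each of ∂i1, ∂i2, ∂i3 is a box: upper bounds on x(j) for j ∈ Y and lower bounds for j ∉ Y.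
-- Diminishing returns, f(j | T) ≤ f(j | S) for S ⊆ T ∌ j, compares the bounds of the three
-- boxes. It also makes f(S) - x(S) monotone along a chain of sets as soon as x(j) bounds, in the
-- right direction, every marginal gain f(j | W) met on the chain: for x ∈ ∂i1 this holds from
-- Z down to Z ∩ Y and then up to Y, for x ∈ ∂i2 from Z up to Z ∪ Y and then down to Y. So
-- ∂i1 and ∂i2 lie in ∂f, which is convex and therefore also contains ∂i(1,2).
module Submission where

open import Defs
open import Level using (Level)
open import Data.Nat using (ℕ)
open import Data.Product using (_×_)
open import Data.Fin.Subset using (Subset; ⊥)

import Algebra.Properties.AbelianGroup as AbelianGroupProperties
import Algebra.Properties.CommutativeSemigroup as CommutativeSemigroupProperties
import Algebra.Properties.Ring as RingProperties
open import Data.Fin using (Fin; zero; suc)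
open import Data.Fin.Subset
  using (⊤; _∪_; _∩_; ⁅_⁆; _∈_; _∉_; _⊆_; inside; outside) renaming (_-_ to _∖_)
open import Data.Fin.Subset.Properties
  using ( _∈?_; ⊆⊤; ⊥⊆; ⊆-antisym; ⊆-refl; s⊆s; out⊆; drop-∷-⊆; drop-there
        ; x∈⁅y⁆⇒x≡y; x∈p∧x≢y⇒x∈p-y; x∈p∪q⁻; x∈p∩q⁺; x∈p∩q⁻; p⊆p∪q; q⊆p∪q; p∩q⊆p; p∩q⊆q
        ; Empty-unique; ∪-assoc; ∪-comm; ∪-identityˡ; ∪-identityʳ; ∩-distribʳ-∪ )
open import Data.Product using (_,_)
open import Data.Sum using (inj₁; inj₂; [_,_])
open import Data.Vec using ([]; _∷_; here; there)
open import Function using (_∘_; id; flip)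
open import Relation.Binary.Bundles using (Poset)
open import Relation.Binary.Core using (Rel)
open import Relation.Binary.Structures using (IsPreorder; IsTotalOrder)
import Relation.Binary.Construct.Flip.EqAndOrd as Flip
import Relation.Binary.Reasoning.Base.Double as PreorderReasoning
import Relation.Binary.Reasoning.PartialOrder as PosetReasoning
open import Relation.Binary.PropositionalEquality
  using (_≡_; refl; cong; cong₂; subst; subst₂; module ≡-Reasoning)
open import Relation.Nullary using (yes; no; contradiction)

private
  variable
    n : ℕ
    x : Fin n
    p q : Subset n

x∉p∖x : x ∉ p ∖ x
x∉p∖x {x = zero}  {p = _ ∷ _} ()
x∉p∖x {x = suc x} {p = _ ∷ p} (there x∈p∖x) = x∉p∖x {x = x} {p = p} x∈p∖x

p⊆q⇒p⊆q∖x : p ⊆ q → x ∉ p → p ⊆ q ∖ x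
p⊆q⇒p⊆q∖x p⊆q x∉p i∈p = x∈p∧x≢y⇒x∈p-y (p⊆q i∈p) λ { refl → x∉p i∈p }

p⊆q⇒p∪q≡q : p ⊆ q → p ∪ q ≡ q
p⊆q⇒p∪q≡q {p = p} {q = q} p⊆q = ⊆-antisym ([ p⊆q , id ] ∘ x∈p∪q⁻ p q) (q⊆p∪q p q)

p⊆q⇒p∩q≡p : p ⊆ q → p ∩ q ≡ p
p⊆q⇒p∩q≡p {p = p} {q = q} p⊆q = ⊆-antisym (p∩q⊆p p q) (λ i∈p → x∈p∩q⁺ (i∈p , p⊆q i∈p))

x∉q⇒⁅x⁆∩q≡⊥ : x ∉ q → ⁅ x ⁆ ∩ q ≡ ⊥
x∉q⇒⁅x⁆∩q≡⊥ {x = x} {q = q} x∉q = Empty-unique λ where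
  (i , i∈⁅x⁆∩q) → let (i∈⁅x⁆ , i∈q) = x∈p∩q⁻ ⁅ x ⁆ q i∈⁅x⁆∩q in
                  x∉q (subst (_∈ q) (x∈⁅y⁆⇒x≡y x i∈⁅x⁆) i∈q)

p∪⁅x⁆∪q≡q∪⁅x⁆ : p ⊆ q → (p ∪ ⁅ x ⁆) ∪ q ≡ q ∪ ⁅ x ⁆
p∪⁅x⁆∪q≡q∪⁅x⁆ {p = p} {q = q} {x = x} p⊆q = begin
  (p ∪ ⁅ x ⁆) ∪ q  ≡⟨ ∪-assoc p ⁅ x ⁆ q ⟩
  p ∪ (⁅ x ⁆ ∪ q)  ≡⟨ cong (p ∪_) (∪-comm ⁅ x ⁆ q) ⟩
  p ∪ (q ∪ ⁅ x ⁆)  ≡⟨ ∪-assoc p q ⁅ x ⁆ ⟨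
  (p ∪ q) ∪ ⁅ x ⁆  ≡⟨ cong (_∪ ⁅ x ⁆) (p⊆q⇒p∪q≡q p⊆q) ⟩
  q ∪ ⁅ x ⁆        ∎
  where open ≡-Reasoning

p∪⁅x⁆∩q≡p : p ⊆ q → x ∉ q → (p ∪ ⁅ x ⁆) ∩ q ≡ p
p∪⁅x⁆∩q≡p {p = p} {q = q} {x = x} p⊆q x∉q = begin
  (p ∪ ⁅ x ⁆) ∩ q        ≡⟨ ∩-distribʳ-∪ q p ⁅ x ⁆ ⟩
  (p ∩ q) ∪ (⁅ x ⁆ ∩ q)  ≡⟨ cong₂ _∪_ (p⊆q⇒p∩q≡p p⊆q) (x∉q⇒⁅x⁆∩q≡⊥ x∉q) ⟩
  p ∪ ⊥                  ≡⟨ ∪-identityʳ p ⟩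
  p                      ∎
  where open ≡-Reasoning

module SubmodularPolyhedra {c ℓ₁ ℓ₂ : Level} (F : OrderedField c ℓ₁ ℓ₂) where

  open OrderedField F hiding (zero)
  open SubmodularDefs F
  open AbelianGroupProperties +-abelianGroup
    using (ε⁻¹≈ε; ⁻¹-involutive; ⁻¹-∙-comm; //-rightDividesˡ; //-rightDividesʳ)
  open CommutativeSemigroupProperties +-commutativeSemigroup using (interchange; x∙yz≈xz∙y; xy∙z≈xz∙y)
  open RingProperties ring using (-1*x≈-x; x[y-z]≈xy-xz)
  open IsTotalOrder isTotalOrder using (total; isPartialOrder) renaming (isPreorder to ≤-isPreorder)
  open IsPreorder ≤-isPreorder using () renaming (refl to ≤-refl; trans to ≤-trans)

  x-[y+z]≈x-y-z : ∀ x y z → x - (y + z) ≈ (x - y) - z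
  x-[y+z]≈x-y-z x y z = trans (+-congˡ (sym (⁻¹-∙-comm y z))) (sym (+-assoc x (- y) (- z)))

  x-[z+y]≈x-y-z : ∀ x y z → x - (z + y) ≈ (x - y) - z
  x-[z+y]≈x-y-z x y z = trans (+-congˡ (sym (⁻¹-∙-comm z y))) (x∙yz≈xz∙y x (- z) (- y))

  [x+y]-z≈[x-z]+y : ∀ x y z → (x + y) - z ≈ (x - z) + y
  [x+y]-z≈[x-z]+y x y z = xy∙z≈xz∙y x y (- z)

  module Telescoping (_≲_ : Rel Carrier ℓ₂) (≲-isPreorder : IsPreorder _≈_ _≲_)
                     (+-monoˡ-≲ : ∀ z {x y} → x ≲ y → (x + z) ≲ (y + z)) where

    open IsPreorder ≲-isPreorder using () renaming (refl to ≲-refl)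
    open PreorderReasoning ≲-isPreorder

    x+y≲z⇒x≲z-y : ∀ {x y z} → (x + y) ≲ z → x ≲ (z - y)
    x+y≲z⇒x≲z-y {x} {y} {z} x+y≲z = begin
      x            ≈⟨ //-rightDividesʳ y x ⟨
      (x + y) - y  ≲⟨ +-monoˡ-≲ (- y) x+y≲z ⟩
      z - y        ∎

    x≲y+z⇒x-z≲y : ∀ {x y z} → x ≲ (y + z) → (x - z) ≲ y
    x≲y+z⇒x-z≲y {x} {y} {z} x≲y+z = begin
      x - z        ≲⟨ +-monoˡ-≲ (- z) x≲y+z ⟩
      (y + z) - z  ≈⟨ //-rightDividesʳ z y ⟩
      y            ∎

    x-y≲z⇒x-z≲y : ∀ {x y z} → (x - y) ≲ z → (x - z) ≲ y
    x-y≲z⇒x-z≲y {x} {y} {z} x-y≲z = x≲y+z⇒x-z≲y (begin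
      x            ≈⟨ //-rightDividesˡ y x ⟨
      (x - y) + y  ≲⟨ +-monoˡ-≲ y x-y≲z ⟩
      z + y        ≈⟨ +-comm z y ⟩
      y + z        ∎)

    x+y≲z+w⇒x-w≲z-y : ∀ {x y z w} → (x + y) ≲ (z + w) → (x - w) ≲ (z - y)
    x+y≲z+w⇒x-w≲z-y {x} {y} {z} {w} x+y≲z+w = x≲y+z⇒x-z≲y (begin
      x            ≲⟨ x+y≲z⇒x≲z-y x+y≲z+w ⟩
      (z + w) - y  ≈⟨ [x+y]-z≈[x-z]+y z w y ⟩
      (z - y) + w  ∎)

    x-y≲z-w⇒x-[v+y]≲z-[v+w] : ∀ {x y z w} v → (x - y) ≲ (z - w) → (x - (v + y)) ≲ (z - (v + w))
    x-y≲z-w⇒x-[v+y]≲z-[v+w] {x} {y} {z} {w} v x-y≲z-w = begin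
      x - (v + y)  ≈⟨ x-[z+y]≈x-y-z x y v ⟩
      (x - y) - v  ≲⟨ +-monoˡ-≲ (- v) x-y≲z-w ⟩
      (z - w) - v  ≈⟨ x-[z+y]≈x-y-z z w v ⟨
      z - (v + w)  ∎

    telescope : ∀ {n} (f : Subset n → Carrier) (x : Fin n → Carrier) {Q R : Subset n} → Q ⊆ R →
                (∀ {W j} → Q ⊆ W → W ⊆ R → j ∈ R → j ∉ W → marg f j W ≲ x j) →
                (f R - x ⟨ R ⟩) ≲ (f Q - x ⟨ Q ⟩)
    telescope f x {[]} {[]} _ _ = ≲-refl
    telescope f x {outside ∷ Q} {outside ∷ R} Q⊆R bounded =
      x-y≲z-w⇒x-[v+y]≲z-[v+w] 0# (telescope (f ∘ (outside ∷_)) (x ∘ suc) (drop-∷-⊆ Q⊆R)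
        λ Q⊆W W⊆R j∈R j∉W → bounded (s⊆s Q⊆W) (s⊆s W⊆R) (there j∈R) (j∉W ∘ drop-there))
    telescope f x {inside ∷ Q} {inside ∷ R} Q⊆R bounded =
      x-y≲z-w⇒x-[v+y]≲z-[v+w] (x zero) (telescope (f ∘ (inside ∷_)) (x ∘ suc) (drop-∷-⊆ Q⊆R)
        λ Q⊆W W⊆R j∈R j∉W → bounded (s⊆s Q⊆W) (s⊆s W⊆R) (there j∈R) (j∉W ∘ drop-there))
    telescope f x {outside ∷ Q} {inside ∷ R} Q⊆R bounded = begin
      f (inside ∷ R) - (x zero + s)  ≈⟨ x-[y+z]≈x-y-z _ (x zero) s ⟩
      (f (inside ∷ R) - x zero) - s  ≲⟨ +-monoˡ-≲ (- s) (x-y≲z⇒x-z≲y gain) ⟩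
      f (outside ∷ R) - s            ≲⟨ rest ⟩
      f (outside ∷ Q) - t            ≈⟨ +-congˡ (-‿cong (+-identityˡ t)) ⟨
      f (outside ∷ Q) - (0# + t)     ∎
      where
      s t : Carrier
      s = (x ∘ suc) ⟨ R ⟩
      t = (x ∘ suc) ⟨ Q ⟩
      gain : (f (inside ∷ R) - f (outside ∷ R)) ≲ x zero
      gain = subst (λ S → (f (inside ∷ S) - f (outside ∷ R)) ≲ x zero) (∪-identityʳ R)
               (bounded (s⊆s (drop-∷-⊆ Q⊆R)) (out⊆ ⊆-refl) here λ ())
      rest : (f (outside ∷ R) - s) ≲ (f (outside ∷ Q) - t)
      rest = telescope (f ∘ (outside ∷_)) (x ∘ suc) (drop-∷-⊆ Q⊆R)
        λ Q⊆W W⊆R j∈R j∉W → bounded (s⊆s Q⊆W) (out⊆ W⊆R) (there j∈R) (j∉W ∘ drop-there)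
    telescope f x {inside ∷ Q} {outside ∷ R} Q⊆R _ with () ← Q⊆R here

  module ≤ = Telescoping _≤_ ≤-isPreorder (λ z → +-monoˡ-≤ z)
  module ≥ = Telescoping (flip _≤_) (Flip.isPreorder ≤-isPreorder) (λ z → +-monoˡ-≤ z)

  poset : Poset c ℓ₁ ℓ₂
  poset = record { isPartialOrder = isPartialOrder }

  open PosetReasoning poset

  +-mono-≤ : ∀ {x y z w} → x ≤ y → z ≤ w → x + z ≤ y + w
  +-mono-≤ {x} {y} {z} {w} x≤y z≤w = begin
    x + z  ≤⟨ +-monoˡ-≤ z x≤y ⟩
    y + z  ≈⟨ +-comm y z ⟩
    z + y  ≤⟨ +-monoˡ-≤ y z≤w ⟩
    w + y  ≈⟨ +-comm w y ⟩
    y + w  ∎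

  x≤y⇒0≤y-x : ∀ {x y} → x ≤ y → 0# ≤ y - x
  x≤y⇒0≤y-x {x} {y} x≤y = begin
    0#     ≈⟨ -‿inverseʳ x ⟨
    x - x  ≤⟨ +-monoˡ-≤ (- x) x≤y ⟩
    y - x  ∎

  0≤y-x⇒x≤y : ∀ {x y} → 0# ≤ y - x → x ≤ y
  0≤y-x⇒x≤y {x} {y} 0≤y-x = begin
    x            ≈⟨ +-identityˡ x ⟨
    0# + x       ≤⟨ +-monoˡ-≤ x 0≤y-x ⟩
    (y - x) + x  ≈⟨ //-rightDividesˡ x y ⟩
    y            ∎

  *-monoʳ-≤-nonneg : ∀ {z x y} → 0# ≤ z → x ≤ y → z * x ≤ z * y
  *-monoʳ-≤-nonneg {z} {x} {y} 0≤z x≤y = 0≤y-x⇒x≤y (begin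
    0#             ≤⟨ *-nonneg 0≤z (x≤y⇒0≤y-x x≤y) ⟩
    z * (y - x)    ≈⟨ x[y-z]≈xy-xz z y x ⟩
    z * y - z * x  ∎)

  0≤1 : 0# ≤ 1#
  0≤1 with total 0# 1#
  ... | inj₁ 0≤1 = 0≤1
  ... | inj₂ 1≤0 = begin
    0#           ≤⟨ *-nonneg 0≤-1 0≤-1 ⟩
    - 1# * - 1#  ≈⟨ -1*x≈-x (- 1#) ⟩
    - - 1#       ≈⟨ ⁻¹-involutive 1# ⟩
    1#           ∎
    where
    0≤-1 : 0# ≤ - 1#
    0≤-1 = begin
      0#       ≤⟨ x≤y⇒0≤y-x 1≤0 ⟩
      0# - 1#  ≈⟨ +-identityˡ (- 1#) ⟩
      - 1#     ∎

  1x+[1-1]y≈x : ∀ x y → 1# * x + (1# - 1#) * y ≈ x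
  1x+[1-1]y≈x x y = trans (+-cong (*-identityˡ x) (trans (*-congʳ (-‿inverseʳ 1#)) (zeroˡ y)))
                          (+-identityʳ x)

  0x+[1-0]y≈y : ∀ x y → 0# * x + (1# - 0#) * y ≈ y
  0x+[1-0]y≈y x y = trans (+-cong (zeroˡ x) (trans (*-congʳ 1-0≈1) (*-identityˡ y))) (+-identityˡ y)
    where
    1-0≈1 : 1# - 0# ≈ 1#
    1-0≈1 = trans (+-congˡ ε⁻¹≈ε) (+-identityʳ 1#)

  [x+y]-[z+w]≈[x-z]+[y-w] : ∀ x y z w → (x + y) - (z + w) ≈ (x - z) + (y - w)
  [x+y]-[z+w]≈[x-z]+[y-w] x y z w = trans (+-congˡ (sym (⁻¹-∙-comm z w))) (interchange x y (- z) (- w))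

  x-[λy+[1-λ]z]≈λ[x-y]+[1-λ][x-z] : ∀ λ′ x y z →
    x - (λ′ * y + (1# - λ′) * z) ≈ λ′ * (x - y) + (1# - λ′) * (x - z)
  x-[λy+[1-λ]z]≈λ[x-y]+[1-λ][x-z] λ′ x y z = begin-equality
    x - (λ′ * y + μ * z)                  ≈⟨ +-congʳ (*-identityˡ x) ⟨
    1# * x - (λ′ * y + μ * z)             ≈⟨ +-congʳ (*-congʳ λ+μ≈1) ⟨
    (λ′ + μ) * x - (λ′ * y + μ * z)       ≈⟨ +-congʳ (distribʳ x λ′ μ) ⟩
    (λ′ * x + μ * x) - (λ′ * y + μ * z)   ≈⟨ [x+y]-[z+w]≈[x-z]+[y-w] (λ′ * x) (μ * x) (λ′ * y) (μ * z) ⟩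
    (λ′ * x - λ′ * y) + (μ * x - μ * z)   ≈⟨ +-cong (x[y-z]≈xy-xz λ′ x y) (x[y-z]≈xy-xz μ x z) ⟨
    λ′ * (x - y) + μ * (x - z)            ∎
    where
    μ : Carrier
    μ = 1# - λ′
    λ+μ≈1 : λ′ + μ ≈ 1#
    λ+μ≈1 = trans (+-comm λ′ μ) (//-rightDividesˡ λ′ 1#)

  0≈λ0+μ0 : ∀ λ′ μ → 0# ≈ λ′ * 0# + μ * 0#
  0≈λ0+μ0 λ′ μ = sym (trans (+-cong (zeroʳ λ′) (zeroʳ μ)) (+-identityʳ 0#))

  +-linear : ∀ {λ′ μ x y z x′ y′ z′} → x ≈ λ′ * y + μ * z → x′ ≈ λ′ * y′ + μ * z′ →
             x + x′ ≈ λ′ * (y + y′) + μ * (z + z′)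
  +-linear {λ′} {μ} {x} {y} {z} {x′} {y′} {z′} x≈ x′≈ = begin-equality
    x + x′                                ≈⟨ +-cong x≈ x′≈ ⟩
    (λ′ * y + μ * z) + (λ′ * y′ + μ * z′)  ≈⟨ interchange (λ′ * y) (μ * z) (λ′ * y′) (μ * z′) ⟩
    (λ′ * y + λ′ * y′) + (μ * z + μ * z′)  ≈⟨ +-cong (distribˡ λ′ y y′) (distribˡ μ z z′) ⟨
    λ′ * (y + y′) + μ * (z + z′)           ∎

  ⟨⟩-linear : ∀ {n} {x y z : Fin n → Carrier} λ′ μ → (∀ i → x i ≈ λ′ * y i + μ * z i) →
              ∀ S → x ⟨ S ⟩ ≈ λ′ * y ⟨ S ⟩ + μ * z ⟨ S ⟩
  ⟨⟩-linear λ′ μ x≈ []            = 0≈λ0+μ0 λ′ μ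
  ⟨⟩-linear λ′ μ x≈ (inside ∷ S)  = +-linear (x≈ zero) (⟨⟩-linear λ′ μ (x≈ ∘ suc) S)
  ⟨⟩-linear λ′ μ x≈ (outside ∷ S) = +-linear (0≈λ0+μ0 λ′ μ) (⟨⟩-linear λ′ μ (x≈ ∘ suc) S)

  ∂f-convex : ∀ {n} {f : Subset n → Carrier} {Y x x₁ x₂} λ′ → 0# ≤ λ′ → λ′ ≤ 1# →
              ∂f f Y x₁ → ∂f f Y x₂ → (∀ i → x i ≈ λ′ * x₁ i + (1# - λ′) * x₂ i) → ∂f f Y x
  ∂f-convex {f = f} {Y} {x} {x₁} {x₂} λ′ 0≤λ λ≤1 x₁∈∂f x₂∈∂f x≈ Z = begin
    f Z - x ⟨ Z ⟩                                        ≈⟨ split Z ⟩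
    λ′ * (f Z - x₁ ⟨ Z ⟩) + μ * (f Z - x₂ ⟨ Z ⟩)          ≤⟨ +-mono-≤ (*-monoʳ-≤-nonneg 0≤λ (x₁∈∂f Z))
                                                                     (*-monoʳ-≤-nonneg 0≤μ (x₂∈∂f Z)) ⟩
    λ′ * (f Y - x₁ ⟨ Y ⟩) + μ * (f Y - x₂ ⟨ Y ⟩)          ≈⟨ split Y ⟨
    f Y - x ⟨ Y ⟩                                        ∎
    where
    μ : Carrier
    μ = 1# - λ′
    0≤μ : 0# ≤ μ
    0≤μ = x≤y⇒0≤y-x λ≤1
    split : ∀ S → f S - x ⟨ S ⟩ ≈ λ′ * (f S - x₁ ⟨ S ⟩) + μ * (f S - x₂ ⟨ S ⟩)
    split S = trans (+-congˡ (-‿cong (⟨⟩-linear λ′ μ x≈ S)))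
                    (x-[λy+[1-λ]z]≈λ[x-y]+[1-λ][x-z] λ′ (f S) (x₁ ⟨ S ⟩) (x₂ ⟨ S ⟩))

  module Marginals {n} {f : Subset n → Carrier} (submodular : Submodular f) where

    marg-antitone : ∀ {S T j} → S ⊆ T → j ∉ T → marg f j T ≤ marg f j S
    marg-antitone {S} {T} {j} S⊆T j∉T = ≤.x+y≲z+w⇒x-w≲z-y
      (subst₂ (λ A B → f A + f B ≤ f (S ∪ ⁅ j ⁆) + f T) (p∪⁅x⁆∪q≡q∪⁅x⁆ S⊆T) (p∪⁅x⁆∩q≡p S⊆T j∉T)
              (submodular (S ∪ ⁅ j ⁆) T))

    marg-removed≤marg : ∀ {T W j} → W ⊆ T → j ∉ W → marg f j (T ∖ j) ≤ marg f j W
    marg-removed≤marg {T} {W} {j} W⊆T j∉W = marg-antitone (p⊆q⇒p⊆q∖x W⊆T j∉W) (x∉p∖x {p = T})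

    marg≤singleton : f ⊥ ≈ 0# → ∀ {W j} → j ∉ W → marg f j W ≤ f ⁅ j ⁆
    marg≤singleton f⊥≈0 {W} {j} j∉W = begin
      marg f j W                  ≤⟨ marg-antitone ⊥⊆ j∉W ⟩
      f (⊥ ∪ ⁅ j ⁆) - f ⊥         ≈⟨ +-cong (reflexive (cong f (∪-identityˡ ⁅ j ⁆))) (-‿cong f⊥≈0) ⟩
      f ⁅ j ⁆ - 0#                ≈⟨ trans (+-congˡ ε⁻¹≈ε) (+-identityʳ (f ⁅ j ⁆)) ⟩
      f ⁅ j ⁆                     ∎

  -- ∂i1 f Y, ∂i2 f Y and ∂i3 f Y unfold to instances of Box Y.
  Box : ∀ {n} → Subset n → (upper lower : Fin n → Carrier) → (Fin n → Carrier) → Set ℓ₂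
  Box Y upper lower x = (∀ j → j ∈ Y → x j ≤ upper j) × (∀ j → j ∉ Y → lower j ≤ x j)

  Box-mono : ∀ {n} {Y : Subset n} {u u′ l l′} →
             (∀ j → j ∈ Y → u j ≤ u′ j) → (∀ j → j ∉ Y → l′ j ≤ l j) →
             Box Y u l ⊑ Box Y u′ l′
  Box-mono u≤u′ l′≤l x (x≤u , l≤x) =
    (λ j j∈Y → ≤-trans (x≤u j j∈Y) (u≤u′ j j∈Y)) , (λ j j∉Y → ≤-trans (l′≤l j j∉Y) (l≤x j j∉Y))

  corner : ∀ {n} → Subset n → (upper lower : Fin n → Carrier) → Fin n → Carrier
  corner Y upper lower j with j ∈? Y
  ... | yes _ = upper j
  ... | no _  = lower j

  corner∈Box : ∀ {n} (Y : Subset n) upper lower → Box Y upper lower (corner Y upper lower)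
  corner∈Box Y upper lower = corner≤upper , lower≤corner
    where
    corner≤upper : ∀ j → j ∈ Y → corner Y upper lower j ≤ upper j
    corner≤upper j j∈Y with j ∈? Y
    ... | yes _   = ≤-refl
    ... | no j∉Y  = contradiction j∈Y j∉Y
    lower≤corner : ∀ j → j ∉ Y → lower j ≤ corner Y upper lower j
    lower≤corner j j∉Y with j ∈? Y
    ... | yes j∈Y = contradiction j∈Y j∉Y
    ... | no _    = ≤-refl

  module Inclusions {n} {f : Subset n → Carrier} (submodular : Submodular f) (f⊥≈0 : f ⊥ ≈ 0#)
                    (Y : Subset n) where

    open Marginals submodular

    ∂i3⊑∂i2 : ∂i3 f Y ⊑ ∂i2 f Y
    ∂i3⊑∂i2 = Box-mono (λ _ _ → ≤-refl) (λ _ → marg≤singleton f⊥≈0)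

    ∂i3⊑∂i1 : ∂i3 f Y ⊑ ∂i1 f Y
    ∂i3⊑∂i1 = Box-mono (λ j _ → marg-removed≤marg ⊆⊤ (x∉p∖x {p = Y})) (λ _ _ → ≤-refl)

    ∂i1⊑∂f : ∂i1 f Y ⊑ ∂f f Y
    ∂i1⊑∂f x (x≤ , ≤x) Z = ≤-trans (≤.telescope f x (p∩q⊆p Z Y) down) (≥.telescope f x (p∩q⊆q Z Y) up)
      where
      down : ∀ {W j} → Z ∩ Y ⊆ W → W ⊆ Z → j ∈ Z → j ∉ W → marg f j W ≤ x j
      down Z∩Y⊆W _ j∈Z j∉W =
        ≤-trans (marg≤singleton f⊥≈0 j∉W) (≤x _ λ j∈Y → j∉W (Z∩Y⊆W (x∈p∩q⁺ (j∈Z , j∈Y))))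
      up : ∀ {W j} → Z ∩ Y ⊆ W → W ⊆ Y → j ∈ Y → j ∉ W → x j ≤ marg f j W
      up _ W⊆Y j∈Y j∉W = ≤-trans (x≤ _ j∈Y) (marg-removed≤marg W⊆Y j∉W)

    ∂i2⊑∂f : ∂i2 f Y ⊑ ∂f f Y
    ∂i2⊑∂f x (x≤ , ≤x) Z = ≤-trans (≥.telescope f x (p⊆p∪q Y) up) (≤.telescope f x (q⊆p∪q Z Y) down)
      where
      up : ∀ {W j} → Z ⊆ W → W ⊆ Z ∪ Y → j ∈ Z ∪ Y → j ∉ W → x j ≤ marg f j W
      up {j = j} Z⊆W _ j∈Z∪Y j∉W = ≤-trans (x≤ _ j∈Y) (marg-removed≤marg ⊆⊤ j∉W)
        where
        j∈Y : j ∈ Y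
        j∈Y = [ (λ j∈Z → contradiction (Z⊆W j∈Z) j∉W) , id ] (x∈p∪q⁻ Z Y j∈Z∪Y)
      down : ∀ {W j} → Y ⊆ W → W ⊆ Z ∪ Y → j ∈ Z ∪ Y → j ∉ W → marg f j W ≤ x j
      down Y⊆W _ _ j∉W = ≤-trans (marg-antitone Y⊆W j∉W) (≤x _ (j∉W ∘ Y⊆W))

    ∂i12⊑∂f : ∂i12 f Y ⊑ ∂f f Y
    ∂i12⊑∂f x (λ′ , x₁ , x₂ , 0≤λ , λ≤1 , x₁∈∂i1 , x₂∈∂i2 , x≈) =
      ∂f-convex λ′ 0≤λ λ≤1 (∂i1⊑∂f x₁ x₁∈∂i1) (∂i2⊑∂f x₂ x₂∈∂i2) x≈

    ∂i1⊑∂i12 : ∂i1 f Y ⊑ ∂i12 f Y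
    ∂i1⊑∂i12 x x∈∂i1 =
      1# , x , x₂ , 0≤1 , ≤-refl , x∈∂i1 , corner∈Box Y _ _ , λ i → sym (1x+[1-1]y≈x (x i) (x₂ i))
      where
      x₂ : Fin n → Carrier
      x₂ = corner Y (λ j → marg f j (⊤ ∖ j)) (λ j → marg f j Y)

    ∂i2⊑∂i12 : ∂i2 f Y ⊑ ∂i12 f Y
    ∂i2⊑∂i12 x x∈∂i2 =
      0# , x₁ , x , ≤-refl , 0≤1 , corner∈Box Y _ _ , x∈∂i2 , λ i → sym (0x+[1-0]y≈y (x₁ i) (x i))
      where
      x₁ : Fin n → Carrier
      x₁ = corner Y (λ j → marg f j (Y ∖ j)) (λ j → f ⁅ j ⁆)

lemma11 : ∀ {c ℓ₁ ℓ₂ : Level} (F : OrderedField c ℓ₁ ℓ₂) (n : ℕ)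
            (f : Subset n → OrderedField.Carrier F) (Y : Subset n) →
            SubmodularDefs.Submodular F f →
            OrderedField._≈_ F (f ⊥) (OrderedField.0# F) →
            let open SubmodularDefs F in
            (∂i3 f Y ⊑ ∂i2 f Y) × (∂i2 f Y ⊑ ∂i12 f Y) × (∂i12 f Y ⊑ ∂f f Y)
            × (∂i3 f Y ⊑ ∂i1 f Y) × (∂i1 f Y ⊑ ∂i12 f Y)
lemma11 F n f Y submodular f⊥≈0 = ∂i3⊑∂i2 , ∂i2⊑∂i12 , ∂i12⊑∂f , ∂i3⊑∂i1 , ∂i1⊑∂i12
  where open SubmodularPolyhedra.Inclusions F submodular f⊥≈0 Y
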